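{- Let $D$ be an orientation of an $r$-regular graph $G$. If a pair of distinct vertices $u,v$ is full in $D$, then the out-degree of $u$ equals the in-degree of $v$.
   Context: Graphs are finite and simple. An orientation of $G$ is obtained by directing each edge. For a digraph $D$ and distinct vertices $u,v$, $\kappa_D(u,v)$ is the maximum number of internally disjoint directed $u$--$v$ paths, and $\theta_D(u,v)=\kappa_D(u,v)+\kappa_D(v,u)$. A pair $u,v$ is full in the orientation $D$ of $G$ if $\theta_D(u,v)=\min\{\deg_G(u),\deg_G(v)\}$ (here, $=r$). -}

module Defs where

open import Data.Nat using (ℕ; zero; suc; _+_; _≤_; _⊓_)
open import Data.Bool using (Bool; true; false; _∧_; _∨_; if_then_else_)
open import Data.Fin using (Fin)
open import Data.List using (List; []; _∷_; _++_; [_]; map; allFin)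
open import Data.Nat.ListAction using (sum)
open import Data.List.Membership.Propositional using (_∈_)
open import Data.List.Relation.Unary.Unique.Propositional using (Unique)
open import Data.Product using (Σ; _×_; _,_)
open import Data.Unit using (⊤)
open import Data.Empty using (⊥)
open import Relation.Nullary using (¬_)
open import Relation.Binary.PropositionalEquality using (_≡_; _≢_)

record Graph (n : ℕ) : Set where
  field
    adj     : Fin n → Fin n → Bool
    symm    : ∀ x y → adj x y ≡ adj y x
    irrefl  : ∀ x → adj x x ≡ false

open Graph public

countTrue : ∀ {n} → (Fin n → Bool) → ℕ
countTrue {n} f = sum (map (λ y → if f y then 1 else 0) (allFin n))

deg : ∀ {n} → Graph n → Fin n → ℕ
deg G x = countTrue (adj G x)

Regular : ∀ {n} → Graph n → ℕ → Set
Regular G r = ∀ x → deg G x ≡ r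

record Orientation {n : ℕ} (G : Graph n) : Set where
  field
    arc       : Fin n → Fin n → Bool
    covers    : ∀ x y → adj G x y ≡ (arc x y ∨ arc y x)
    antisym   : ∀ x y → (arc x y ∧ arc y x) ≡ false

open Orientation public

outdeg : ∀ {n} {G : Graph n} → Orientation G → Fin n → ℕ
outdeg D x = countTrue (λ y → arc D x y)

indeg : ∀ {n} {G : Graph n} → Orientation G → Fin n → ℕ
indeg D x = countTrue (λ y → arc D y x)

Arcs : ∀ {n} {G : Graph n} → Orientation G → List (Fin n) → Set
Arcs D []           = ⊤
Arcs D (x ∷ [])     = ⊤
Arcs D (x ∷ y ∷ xs) = (arc D x y ≡ true) × Arcs D (y ∷ xs)

IsPath : ∀ {n} {G : Graph n} → Orientation G → Fin n → Fin n → List (Fin n) → Set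
IsPath D u v inner = Unique (u ∷ inner ++ [ v ]) × Arcs D (u ∷ inner ++ [ v ])

DisjointPaths : ∀ {n} {G : Graph n} → Orientation G → Fin n → Fin n → ℕ → Set
DisjointPaths {n} D u v k =
  Σ (Fin k → List (Fin n)) λ P →
    (∀ i → IsPath D u v (P i)) ×
    (∀ i j → i ≢ j → (P i ≢ P j) × (∀ x → x ∈ P i → x ∈ P j → ⊥))

IsKappa : ∀ {n} {G : Graph n} → Orientation G → Fin n → Fin n → ℕ → Set
IsKappa D u v k = DisjointPaths D u v k × (∀ m → DisjointPaths D u v m → m ≤ k)

Full : ∀ {n} {G : Graph n} → Orientation G → Fin n → Fin n → Set
Full {G = G} D u v = ∀ a b → IsKappa D u v a → IsKappa D v u b → a + b ≡ deg G u ⊓ deg G v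

-- Every directed u–v path leaves u along an out-arc of u and enters v along
-- an in-arc of v, and internally disjoint paths use distinct such arcs; hence
-- κ(u,v) ≤ out(u), κ(u,v) ≤ in(v), κ(v,u) ≤ in(u) and κ(v,u) ≤ out(v).
-- Fullness in an r-regular graph gives κ(u,v) + κ(v,u) = r = out(u) + in(u)
-- = in(v) + out(v), so all four bounds are tight and out(u) = κ(u,v) = in(v).
-- The maxima κ exist only classically, which suffices for the decidable
-- conclusion.
module Submission where

open import Defs
open import Data.Bool using (Bool; true; false; _∧_; _∨_; if_then_else_)
open import Data.Empty using (⊥)
open import Data.Fin using (Fin; zero; suc; punchIn; punchOut)
open import Data.Fin.Properties using (¬Fin0; any?; punchIn-injective; punchInᵢ≢i; punchIn-punchOut; punchOut-injective)
  renaming (_≟_ to _≟ᶠ_)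
open import Data.List using (List; []; _∷_; _++_; [_]; allFin)
open import Data.List.Membership.Propositional using (_∈_; _∉_)
open import Data.List.Membership.Propositional.Properties using (∈-++⁺ˡ; ∈-++⁺ʳ)
open import Data.List.Properties using (map-cong; map-tabulate)
open import Data.List.Relation.Unary.All using (lookup)
open import Data.List.Relation.Unary.AllPairs using (_∷_)
open import Data.List.Relation.Unary.Any using (here; there)
open import Data.List.Relation.Unary.Unique.Propositional using (Unique)
open import Data.List.Relation.Unary.Unique.Propositional.Properties using (Unique[x∷xs]⇒x∉xs)
open import Data.Nat using (ℕ; zero; suc; _+_; _≤_; _⊓_; z≤n; s≤s; _≟_)
open import Data.Nat.ListAction using (sum)
open import Data.Nat.Properties
open import Algebra.Properties.CommutativeSemigroup +-commutativeSemigroup using (interchange)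
open import Data.Product using (∃; _×_; _,_; proj₁; proj₂)
open import Function using (_∘_; case_of_)
open import Function.Definitions using (Injective)
open import Relation.Nullary using (¬_; yes; no; contradiction)
open import Relation.Nullary.Decidable using (decidable-stable)
open import Relation.Binary.PropositionalEquality using (_≡_; _≢_; _≗_; refl; sym; trans; cong; cong₂; subst)

open ≤-Reasoning

bit : Bool → ℕ
bit b = if b then 1 else 0

bit-∨ : ∀ a b → (a ∧ b) ≡ false → bit (a ∨ b) ≡ bit a + bit b
bit-∨ true  true  ()
bit-∨ true  false _ = refl
bit-∨ false b     _ = refl

countTrue-cong : ∀ {n} {f g : Fin n → Bool} → f ≗ g → countTrue f ≡ countTrue g
countTrue-cong {n} f≗g = cong sum (map-cong (cong bit ∘ f≗g) (allFin n))

countTrue-suc : ∀ {n} (g : Fin (suc n) → Bool) → countTrue g ≡ bit (g zero) + countTrue (g ∘ suc)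
countTrue-suc g = cong (bit (g zero) +_) (cong sum
  (trans (map-tabulate suc (bit ∘ g)) (sym (map-tabulate (λ i → i) (bit ∘ g ∘ suc)))))

countTrue-∨ : ∀ {n} (f g : Fin n → Bool) → (∀ y → (f y ∧ g y) ≡ false) →
              countTrue (λ y → f y ∨ g y) ≡ countTrue f + countTrue g
countTrue-∨ {zero}  f g disjoint = refl
countTrue-∨ {suc n} f g disjoint = begin-equality
  countTrue (λ y → f y ∨ g y)
    ≡⟨ countTrue-suc (λ y → f y ∨ g y) ⟩
  bit (f zero ∨ g zero) + countTrue (λ y → f (suc y) ∨ g (suc y))
    ≡⟨ cong₂ _+_ (bit-∨ (f zero) (g zero) (disjoint zero)) (countTrue-∨ (f ∘ suc) (g ∘ suc) (disjoint ∘ suc)) ⟩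
  (bit (f zero) + bit (g zero)) + (countTrue (f ∘ suc) + countTrue (g ∘ suc))
    ≡⟨ interchange (bit (f zero)) (bit (g zero)) (countTrue (f ∘ suc)) (countTrue (g ∘ suc)) ⟩
  (bit (f zero) + countTrue (f ∘ suc)) + (bit (g zero) + countTrue (g ∘ suc))
    ≡⟨ sym (cong₂ _+_ (countTrue-suc f) (countTrue-suc g)) ⟩
  countTrue f + countTrue g ∎

injective⇒≤countTrue : ∀ {m n} (g : Fin n → Bool) (f : Fin m → Fin n) → Injective _≡_ _≡_ f →
                       (∀ i → g (f i) ≡ true) → m ≤ countTrue g
injective⇒≤countTrue {zero}  g f _ _ = z≤n
injective⇒≤countTrue {suc m} {zero} g f _ _ = contradiction (f zero) ¬Fin0
injective⇒≤countTrue {suc m} {suc n} g f f-inj f-true = case any? (λ i → f i ≟ᶠ zero) of λ where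
    (yes (i , fi≡0)) → begin
      suc m                              ≤⟨ s≤s (bound-off-zero (f ∘ punchIn i)
                                               (f-inj-punchIn i) (f-true ∘ punchIn i)
                                               (λ j fj≡0 → punchInᵢ≢i i j (f-inj (trans fj≡0 (sym fi≡0))))) ⟩
      1 + countTrue (g ∘ suc)            ≡⟨ cong (λ b → bit b + countTrue (g ∘ suc))
                                               (sym (subst (λ x → g x ≡ true) fi≡0 (f-true i))) ⟩
      bit (g zero) + countTrue (g ∘ suc) ≡⟨ countTrue-suc g ⟨
      countTrue g                        ∎
    (no zero∉f) → begin
      suc m                              ≤⟨ bound-off-zero f f-inj f-true (λ i fi≡0 → zero∉f (i , fi≡0)) ⟩
      countTrue (g ∘ suc)                ≤⟨ m≤n+m _ (bit (g zero)) ⟩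
      bit (g zero) + countTrue (g ∘ suc) ≡⟨ countTrue-suc g ⟨
      countTrue g                        ∎
  where
  f-inj-punchIn : ∀ i → Injective _≡_ _≡_ (f ∘ punchIn i)
  f-inj-punchIn i = punchIn-injective i _ _ ∘ f-inj

  bound-off-zero : ∀ {k} (h : Fin k → Fin (suc n)) → Injective _≡_ _≡_ h → (∀ i → g (h i) ≡ true) →
                   (∀ i → h i ≢ zero) → k ≤ countTrue (g ∘ suc)
  bound-off-zero h h-inj h-true h≢0 = injective⇒≤countTrue (g ∘ suc) (λ i → punchOut (h≢0 i ∘ sym))
    (λ e → h-inj (punchOut-injective (h≢0 _ ∘ sym) (h≢0 _ ∘ sym) e))
    (λ i → subst (λ x → g x ≡ true) (sym (punchIn-punchOut (h≢0 i ∘ sym))) (h-true i))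

deg≡outdeg+indeg : ∀ {n} {G : Graph n} (D : Orientation G) x → deg G x ≡ outdeg D x + indeg D x
deg≡outdeg+indeg D x = trans (countTrue-cong (covers D x)) (countTrue-∨ (arc D x) (λ y → arc D y x) (antisym D x))

headOr : ∀ {A : Set} → A → List A → A
headOr d []      = d
headOr d (x ∷ _) = x

lastOr : ∀ {A : Set} → A → List A → A
lastOr d []       = d
lastOr d (x ∷ xs) = lastOr x xs

lastOr-∈ : ∀ {A : Set} (x : A) xs → lastOr x xs ∈ x ∷ xs
lastOr-∈ x []       = here refl
lastOr-∈ x (y ∷ ys) = there (lastOr-∈ y ys)

Unique[xs++[x]]⇒x∉xs : ∀ {A : Set} {x : A} xs → Unique (xs ++ [ x ]) → x ∉ xs
Unique[xs++[x]]⇒x∉xs (y ∷ ys) (y∉ys++[x] ∷ _) (here x≡y) = lookup y∉ys++[x] (∈-++⁺ʳ ys (here refl)) (sym x≡y)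
Unique[xs++[x]]⇒x∉xs (y ∷ ys) (_ ∷ unique)    (there x∈ys) = Unique[xs++[x]]⇒x∉xs ys unique x∈ys

choice-separates : ∀ {A : Set} (s : List A → A) {t : A} → s [] ≡ t → (∀ x xs → s (x ∷ xs) ∈ x ∷ xs) →
                   ∀ xs ys → t ∉ xs → t ∉ ys → xs ≢ ys → (∀ x → x ∈ xs → x ∈ ys → ⊥) → s xs ≢ s ys
choice-separates s s[]≡t s∈ []       []       _    _    []≢[] _        _ = []≢[] refl
choice-separates s s[]≡t s∈ []       (y ∷ ys) _    t∉ys _     _        e = t∉ys (subst (_∈ y ∷ ys) (trans (sym e) s[]≡t) (s∈ y ys))
choice-separates s s[]≡t s∈ (x ∷ xs) []       t∉xs _    _     _        e = t∉xs (subst (_∈ x ∷ xs) (trans e s[]≡t) (s∈ x xs))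
choice-separates s s[]≡t s∈ (x ∷ xs) (y ∷ ys) _    _    _     disjoint e = disjoint _ (s∈ x xs) (subst (_∈ y ∷ ys) (sym e) (s∈ y ys))

module _ {n} {G : Graph n} (D : Orientation G) {u v : Fin n} where

  IsPath⇒source∉inner : ∀ {inner} → IsPath D u v inner → u ∉ inner
  IsPath⇒source∉inner (unique , _) = Unique[x∷xs]⇒x∉xs unique ∘ ∈-++⁺ˡ

  IsPath⇒target∉inner : ∀ {inner} → IsPath D u v inner → v ∉ inner
  IsPath⇒target∉inner {inner} ((_ ∷ unique) , _) = Unique[xs++[x]]⇒x∉xs inner unique

  IsPath⇒arc-headOr : ∀ {inner} → IsPath D u v inner → arc D u (headOr v inner) ≡ true
  IsPath⇒arc-headOr {[]}    (_ , u→v , _) = u→v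
  IsPath⇒arc-headOr {_ ∷ _} (_ , u→x , _) = u→x

  Arcs⇒arc-lastOr : ∀ w inner → Arcs D (w ∷ inner ++ [ v ]) → arc D (lastOr w inner) v ≡ true
  Arcs⇒arc-lastOr w []       (w→v , _) = w→v
  Arcs⇒arc-lastOr w (x ∷ xs) (_ , arcs) = Arcs⇒arc-lastOr x xs arcs

  choice∘paths-injective : ∀ {m} (family : DisjointPaths D u v m) (s : List (Fin n) → Fin n) {t : Fin n} →
                           s [] ≡ t → (∀ x xs → s (x ∷ xs) ∈ x ∷ xs) →
                           (∀ {inner} → IsPath D u v inner → t ∉ inner) → Injective _≡_ _≡_ (s ∘ proj₁ family)
  choice∘paths-injective (P , paths , disjoint) s s[]≡t s∈ t∉ {i} {j} e = decidable-stable (i ≟ᶠ j) λ i≢j →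
    choice-separates s s[]≡t s∈ (P i) (P j) (t∉ (paths i)) (t∉ (paths j))
      (proj₁ (disjoint i j i≢j)) (proj₂ (disjoint i j i≢j)) e

  disjointPaths≤outdeg : ∀ {m} → DisjointPaths D u v m → m ≤ outdeg D u
  disjointPaths≤outdeg family@(P , paths , _) = injective⇒≤countTrue (arc D u) (headOr v ∘ P)
    (choice∘paths-injective family (headOr v) refl (λ x xs → here refl) IsPath⇒target∉inner)
    (IsPath⇒arc-headOr ∘ paths)

  disjointPaths≤indeg : ∀ {m} → DisjointPaths D u v m → m ≤ indeg D v
  disjointPaths≤indeg family@(P , paths , _) = injective⇒≤countTrue (λ y → arc D y v) (lastOr u ∘ P)
    (choice∘paths-injective family (lastOr u) refl lastOr-∈ IsPath⇒source∉inner)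
    (λ i → Arcs⇒arc-lastOr u (P i) (proj₂ (paths i)))

≤-tight : ∀ {a b x y} → a ≤ x → b ≤ y → a + b ≡ x + y → a ≡ x
≤-tight {a} {b} {x} {y} a≤x b≤y a+b≡x+y = ≤-antisym a≤x (+-cancelʳ-≤ y x a (begin
  x + y ≡⟨ a+b≡x+y ⟨
  a + b ≤⟨ +-monoʳ-≤ a b≤y ⟩
  a + y ∎))

κ+κ≡deg⇒κ≡outdeg : ∀ {n} {G : Graph n} (D : Orientation G) {x y : Fin n} {a b} →
                    DisjointPaths D x y a → DisjointPaths D y x b → deg G x ≡ a + b → a ≡ outdeg D x
κ+κ≡deg⇒κ≡outdeg D {x} paths paths′ deg≡a+b = ≤-tight (disjointPaths≤outdeg D paths) (disjointPaths≤indeg D paths′)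
  (trans (sym deg≡a+b) (deg≡outdeg+indeg D x))

κ+κ≡deg⇒κ≡indeg : ∀ {n} {G : Graph n} (D : Orientation G) {x y : Fin n} {a b} →
                   DisjointPaths D y x a → DisjointPaths D x y b → deg G x ≡ a + b → a ≡ indeg D x
κ+κ≡deg⇒κ≡indeg D {x} paths paths′ deg≡a+b = ≤-tight (disjointPaths≤indeg D paths) (disjointPaths≤outdeg D paths′)
  (trans (sym deg≡a+b) (trans (deg≡outdeg+indeg D x) (+-comm (outdeg D x) (indeg D x))))

Maximum : (ℕ → Set) → ℕ → Set
Maximum P k = P k × (∀ m → P m → m ≤ k)

¬¬-maximum : (P : ℕ → Set) → ∀ b {k} → P k → (∀ m → P m → m ≤ k + b) → ¬ ¬ ∃ (Maximum P)
¬¬-maximum P zero    {k} pk bounded no-max = no-max (k , pk , λ m pm → subst (m ≤_) (+-identityʳ k) (bounded m pm))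
¬¬-maximum P (suc b) {k} pk bounded no-max = no-max (k , pk , λ m pm → ≮⇒≥ λ k<m →
  ¬¬-maximum P b pm (λ m′ pm′ → begin
    m′          ≤⟨ bounded m′ pm′ ⟩
    k + suc b   ≡⟨ +-suc k b ⟩
    suc k + b   ≤⟨ +-monoˡ-≤ b k<m ⟩
    m + b       ∎) no-max)

¬¬-κ : ∀ {n} {G : Graph n} (D : Orientation G) (u v : Fin n) → ¬ ¬ ∃ (IsKappa D u v)
¬¬-κ D u v = ¬¬-maximum (DisjointPaths D u v) (outdeg D u) {0} ((λ ()) , (λ ()) , (λ ()))
  (λ m paths → disjointPaths≤outdeg D paths)

mainTheorem20 : ∀ {n : ℕ} (G : Graph n) (r : ℕ) → Regular G r →
    (D : Orientation G) (u v : Fin n) → u ≢ v → Full D u v →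
    outdeg D u ≡ indeg D v
mainTheorem20 G r regular D u v _ full =
  decidable-stable (outdeg D u ≟ indeg D v) λ out≢in →
  ¬¬-κ D u v λ (a , κ[u,v]) →
  ¬¬-κ D v u λ (b , κ[v,u]) →
  let a+b≡r : a + b ≡ r
      a+b≡r = trans (full a b κ[u,v] κ[v,u]) (trans (cong₂ _⊓_ (regular u) (regular v)) (⊓-idem r))
      a≡out : a ≡ outdeg D u
      a≡out = κ+κ≡deg⇒κ≡outdeg D (proj₁ κ[u,v]) (proj₁ κ[v,u]) (trans (regular u) (sym a+b≡r))
      a≡in : a ≡ indeg D v
      a≡in = κ+κ≡deg⇒κ≡indeg D (proj₁ κ[u,v]) (proj₁ κ[v,u]) (trans (regular v) (sym a+b≡r))
  in out≢in (trans (sym a≡out) a≡in)
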